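{- The description logics $\mathcal{ALCQUO}$ and $\mathcal{ALCQUOS}elf$ are not closed under substitutions: there exist a concept $C$ of the logic and an elementary action $a$ such that no concept $D$ of the logic satisfies $D^{G}=C^{G[a]}$ for every graph $G$.
   Context: Description logic concepts: $\mathcal{ALC}$ has $C::=\top\mid C_0\mid\exists R.C\mid\neg C\mid C\vee C$ ($C_0$ atomic concepts, $R$ atomic roles); $\mathcal{O}$ adds nominals (singleton concepts), $\mathcal{Q}$ adds counting quantifiers $(<\,n\,R\,C)$ (elements with fewer than $n$ $R$-successors in $C$), $\mathcal{U}$ the universal role $U$, $\mathcal{S}elf$ concepts $\exists R.Self$ (elements with an $R$-loop); no inverse roles. Semantics standard. Graphs $G=(N,E,\Phi_N,\Phi_E,s,t)$ (nodes, edges, node labelling by sets of atomic concepts, edge labelling by atomic roles, source, target) induce interpretations: $C_0^G=\{n\mid C_0\in\Phi_N(n)\}$, $r_0^G=\{(n,m)\mid\exists e.\,s(e)=n,t(e)=m,\Phi_E(e)=r_0\}$, each nominal denotes one node. Elementary actions include node/label/edge addition and deletion, edge redirection, cloning, and the merge $mrg(i,j)$ ($i,j$ nominals), which deletes node $j$, gives $i$ the union of the labels of $i$ and $j$, and replaces $j$ by $i$ as source/target of every edge. -}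

module Defs where

open import Data.Nat using (ℕ; _≡ᵇ_; _<ᵇ_)
open import Data.Bool using (Bool; true; false; _∧_; _∨_; not; if_then_else_)
open import Data.List using (List; []; _∷_; map; filterᵇ; length)
open import Data.Bool.ListAction using (any)
open import Data.List.Membership.Propositional using (_∈_)
open import Data.List.Relation.Unary.All using (All)
open import Data.List.Relation.Unary.Unique.Propositional using (Unique)
open import Data.Product using (_×_)
open import Relation.Binary.PropositionalEquality using (_≡_)

AtomicConcept : Set
AtomicConcept = ℕ

AtomicRole : Set
AtomicRole = ℕ

Nominal : Set
Nominal = ℕ

data Role : Set where
  atom : AtomicRole → Role
  U    : Role

data Logic : Set where
  ALCQUO     : Logic
  ALCQUOSelf : Logic

data Concept : Logic → Set where
  ⊤'    : ∀ {L} → Concept L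
  atomC : ∀ {L} → AtomicConcept → Concept L
  nom   : ∀ {L} → Nominal → Concept L
  ∃'_∙_ : ∀ {L} → Role → Concept L → Concept L
  ¬'_   : ∀ {L} → Concept L → Concept L
  _∨'_  : ∀ {L} → Concept L → Concept L → Concept L
  lt    : ∀ {L} → ℕ → Role → Concept L → Concept L
  self  : AtomicRole → Concept ALCQUOSelf

-- Nodes are identified by natural numbers; the node set is a
-- (duplicate-free) list; edges form a list (multigraph, each edge carrying
-- source, target and role label); nominals are interpreted by nodes.

record Edge : Set where
  constructor edge
  field
    src : ℕ
    tgt : ℕ
    lab : AtomicRole
open Edge public

record Graph : Set where
  field
    nodes  : List ℕ
    edges  : List Edge
    labels : ℕ → AtomicConcept → Bool
    nomI   : Nominal → ℕ
open Graph public

record WellFormed (G : Graph) : Set where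
  field
    uniqueNodes : Unique (nodes G)
    srcNodes    : All (λ e → src e ∈ nodes G) (edges G)
    tgtNodes    : All (λ e → tgt e ∈ nodes G) (edges G)
    nomNodes    : ∀ (o : Nominal) → nomI G o ∈ nodes G

isNode : Graph → ℕ → Bool
isNode G x = any (λ y → x ≡ᵇ y) (nodes G)

rel : Graph → Role → ℕ → ℕ → Bool
rel G (atom r) x y = any (λ e → (src e ≡ᵇ x) ∧ ((tgt e ≡ᵇ y) ∧ (lab e ≡ᵇ r))) (edges G)
rel G U        x y = isNode G x ∧ isNode G y

-- membership of a node in C^G (meaningful for nodes of G)
⟦_⟧ : ∀ {L} → Concept L → Graph → ℕ → Bool
⟦ ⊤' ⟧       G x = true
⟦ atomC A ⟧  G x = labels G x A
⟦ nom o ⟧    G x = x ≡ᵇ nomI G o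
⟦ ∃' R ∙ C ⟧ G x = any (λ y → rel G R x y ∧ ⟦ C ⟧ G y) (nodes G)
⟦ ¬' C ⟧     G x = not (⟦ C ⟧ G x)
⟦ C ∨' D ⟧   G x = ⟦ C ⟧ G x ∨ ⟦ D ⟧ G x
⟦ lt n R C ⟧ G x = length (filterᵇ (λ y → rel G R x y ∧ ⟦ C ⟧ G y) (nodes G)) <ᵇ n
⟦ self r ⟧   G x = rel G (atom r) x x

ext : ∀ {L} → Graph → Concept L → ℕ → Bool
ext G C x = isNode G x ∧ ⟦ C ⟧ G x

SameExt : ∀ {L} → Graph → Concept L → Graph → Concept L → Set
SameExt G D H C = ∀ (x : ℕ) → ext G D x ≡ ext H C x

mrg : Nominal → Nominal → Graph → Graph
mrg i j G =
  if ni ≡ᵇ nj then G else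
  record
    { nodes  = filterᵇ (λ y → not (y ≡ᵇ nj)) (nodes G)
    ; edges  = map (λ e → edge (repl (src e)) (repl (tgt e)) (lab e)) (edges G)
    ; labels = λ x A → if x ≡ᵇ ni then (labels G ni A ∨ labels G nj A) else labels G x A
    ; nomI   = λ o → repl (nomI G o)
    }
  where
    ni = nomI G i
    nj = nomI G j
    repl : ℕ → ℕ
    repl y = if y ≡ᵇ nj then ni else y

-- Without inverse roles a concept only sees outgoing edges, so two unlabelled nodes
-- without outgoing edges that no nominal names satisfy the same concepts.  Hence
-- redirecting the edge 1 → 2 of the graph {0 → 2, 1 → 2} on nodes 0–3 to 1 → 3 changes
-- no extension, by induction on concepts.  Merging 1 into 0, however, leaves 0 with one
-- successor in the first graph and two in the second, which (< 2 r ⊤) detects.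
module Submission where

open import Defs
open import Data.Bool using (Bool; true; false; _∧_; _∨_; not; T?)
open import Data.Bool.ListAction using (any)
open import Data.Empty using (⊥)
open import Data.List using (List; []; _∷_; filterᵇ; length)
open import Data.List.Membership.Propositional using (_∈_)
open import Data.List.Relation.Binary.Permutation.Propositional using (_↭_; ↭-refl; ↭-prep; ↭-swap)
open import Data.List.Relation.Binary.Permutation.Propositional.Properties using (↭-length; filter-↭)
open import Data.List.Relation.Binary.Pointwise using (Pointwise; []; _∷_)
open import Data.List.Relation.Unary.All using (All; []; _∷_)
open import Data.List.Relation.Unary.AllPairs using ([]; _∷_)
open import Data.List.Relation.Unary.Any using (here; there)
open import Data.List.Relation.Unary.Unique.Propositional using (Unique)
open import Data.Nat using (ℕ; suc; _<ᵇ_)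
open import Data.Product using (Σ; _,_; _×_; proj₁)
open import Relation.Binary.PropositionalEquality using (_≡_; _≗_; refl; sym; trans; cong; cong₂; module ≡-Reasoning)
open import Function using (_∘_)
open import Relation.Nullary using (¬_)

count : {A : Set} → (A → Bool) → List A → ℕ
count p xs = length (filterᵇ p xs)

any≡0<ᵇcount : {A : Set} (p : A → Bool) (xs : List A) → any p xs ≡ (0 <ᵇ count p xs)
any≡0<ᵇcount p []       = refl
any≡0<ᵇcount p (x ∷ xs) with p x
... | true  = refl
... | false = any≡0<ᵇcount p xs

count⇒any : {A : Set} (p q : A → Bool) (xs : List A) → count p xs ≡ count q xs → any p xs ≡ any q xs
count⇒any p q xs eq = begin
  any p xs           ≡⟨ any≡0<ᵇcount p xs ⟩
  0 <ᵇ count p xs    ≡⟨ cong (0 <ᵇ_) eq ⟩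
  0 <ᵇ count q xs    ≡⟨ sym (any≡0<ᵇcount q xs) ⟩
  any q xs           ∎
  where open ≡-Reasoning

count-cong : {A : Set} {p q : A → Bool} {xs ys : List A} →
  Pointwise (λ x y → p x ≡ q y) xs ys → count p xs ≡ count q ys
count-cong [] = refl
count-cong {p = p} {q} {x ∷ _} {y ∷ _} (px≡qy ∷ rest) with p x | q y | px≡qy
... | true  | .true  | refl = cong suc (count-cong rest)
... | false | .false | refl = count-cong rest

count-↭ : {A : Set} (p : A → Bool) {xs ys : List A} → xs ↭ ys → count p xs ≡ count p ys
count-↭ p xs↭ys = ↭-length (filter-↭ (T? ∘ p) xs↭ys)

fourNodes : List ℕ
fourNodes = 0 ∷ 1 ∷ 2 ∷ 3 ∷ []

noLabels : ℕ → AtomicConcept → Bool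
noLabels _ _ = false

naming : Nominal → ℕ
naming 1 = 1
naming _ = 0

sharedTarget : Graph
sharedTarget = record
  { nodes = fourNodes ; edges = edge 0 2 0 ∷ edge 1 2 0 ∷ [] ; labels = noLabels ; nomI = naming }

distinctTargets : Graph
distinctTargets = record
  { nodes = fourNodes ; edges = edge 0 2 0 ∷ edge 1 3 0 ∷ [] ; labels = noLabels ; nomI = naming }

unique-fourNodes : Unique fourNodes
unique-fourNodes =
  ((λ ()) ∷ (λ ()) ∷ (λ ()) ∷ []) ∷ ((λ ()) ∷ (λ ()) ∷ []) ∷ ((λ ()) ∷ []) ∷ [] ∷ []

naming∈fourNodes : ∀ o → naming o ∈ fourNodes
naming∈fourNodes 0             = here refl
naming∈fourNodes 1             = there (here refl)
naming∈fourNodes (suc (suc o)) = here refl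

wf-sharedTarget : WellFormed sharedTarget
wf-sharedTarget = record
  { uniqueNodes = unique-fourNodes
  ; srcNodes    = here refl ∷ there (here refl) ∷ []
  ; tgtNodes    = there (there (here refl)) ∷ there (there (here refl)) ∷ []
  ; nomNodes    = naming∈fourNodes
  }

wf-distinctTargets : WellFormed distinctTargets
wf-distinctTargets = record
  { uniqueNodes = unique-fourNodes
  ; srcNodes    = here refl ∷ there (here refl) ∷ []
  ; tgtNodes    = there (there (here refl)) ∷ there (there (there (here refl))) ∷ []
  ; nomNodes    = naming∈fourNodes
  }

successors : Graph → Role → ℕ → (ℕ → Bool) → ℕ → Bool
successors G R x c y = rel G R x y ∧ c y

successors-cong : ∀ G R x H S z {c d : ℕ → Bool} →
  All (λ y → rel G R x y ≡ rel H S z y) fourNodes → c ≗ d →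
  count (successors G R x c) fourNodes ≡ count (successors H S z d) fourNodes
successors-cong G R x H S z {c} {d} rels c≗d = count-cong (diagonal rels)
  where
    diagonal : ∀ {ys} → All (λ y → rel G R x y ≡ rel H S z y) ys →
      Pointwise (λ y y′ → successors G R x c y ≡ successors H S z d y′) ys ys
    diagonal []                = []
    diagonal {y ∷ _} (r ∷ rs) = cong₂ _∧_ r (c≗d y) ∷ diagonal rs

successors-redirect : ∀ {c d : ℕ → Bool} → c ≗ d → c 2 ≡ c 3 → ∀ R x →
  count (successors sharedTarget R x c) fourNodes ≡ count (successors distinctTargets R x d) fourNodes
successors-redirect c≗d c₂≡c₃ U x =
  successors-cong sharedTarget U x distinctTargets U x (refl ∷ refl ∷ refl ∷ refl ∷ []) c≗d
successors-redirect c≗d c₂≡c₃ (atom r) 0 =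
  successors-cong sharedTarget (atom r) 0 distinctTargets (atom r) 0 (refl ∷ refl ∷ refl ∷ refl ∷ []) c≗d
successors-redirect c≗d c₂≡c₃ (atom (suc r)) 1 =
  successors-cong sharedTarget (atom (suc r)) 1 distinctTargets (atom (suc r)) 1 (refl ∷ refl ∷ refl ∷ refl ∷ []) c≗d
successors-redirect c≗d c₂≡c₃ (atom r) (suc (suc x)) =
  successors-cong sharedTarget (atom r) (suc (suc x)) distinctTargets (atom r) (suc (suc x))
                  (refl ∷ refl ∷ refl ∷ refl ∷ []) c≗d
successors-redirect {c} {d} c≗d c₂≡c₃ (atom 0) 1 = begin
  count (successors sharedTarget (atom 0) 1 c) fourNodes
    ≡⟨ count-cong {p = successors sharedTarget (atom 0) 1 c} {q = successors distinctTargets (atom 0) 1 d}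
                  {xs = fourNodes} {ys = 0 ∷ 1 ∷ 3 ∷ 2 ∷ []} (refl ∷ refl ∷ trans c₂≡c₃ (c≗d 3) ∷ refl ∷ []) ⟩
  count (successors distinctTargets (atom 0) 1 d) (0 ∷ 1 ∷ 3 ∷ 2 ∷ [])
    ≡⟨ count-↭ (successors distinctTargets (atom 0) 1 d) (↭-prep 0 (↭-prep 1 (↭-swap 3 2 ↭-refl))) ⟩
  count (successors distinctTargets (atom 0) 1 d) fourNodes
    ∎
  where open ≡-Reasoning

successors-twins : ∀ (c : ℕ → Bool) R →
  count (successors sharedTarget R 2 c) fourNodes ≡ count (successors sharedTarget R 3 c) fourNodes
successors-twins c U =
  successors-cong sharedTarget U 2 sharedTarget U 3 {c} {c} (refl ∷ refl ∷ refl ∷ refl ∷ []) (λ _ → refl)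
successors-twins c (atom r) =
  successors-cong sharedTarget (atom r) 2 sharedTarget (atom r) 3 {c} {c} (refl ∷ refl ∷ refl ∷ refl ∷ []) (λ _ → refl)

-- Simultaneous induction: the invariance under redirection needs the twins at the successors.
redirect-invisible : ∀ {L} (D : Concept L) →
  (⟦ D ⟧ sharedTarget ≗ ⟦ D ⟧ distinctTargets) × (⟦ D ⟧ sharedTarget 2 ≡ ⟦ D ⟧ sharedTarget 3)
redirect-invisible ⊤'                  = (λ _ → refl) , refl
redirect-invisible (atomC A)           = (λ _ → refl) , refl
redirect-invisible (nom 0)             = (λ _ → refl) , refl
redirect-invisible (nom 1)             = (λ _ → refl) , refl
redirect-invisible (nom (suc (suc o))) = (λ _ → refl) , refl
redirect-invisible (∃' R ∙ C) with redirect-invisible C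
... | C≗ , C₂≡C₃ =
  (λ x → count⇒any (successors sharedTarget R x _) (successors distinctTargets R x _) fourNodes
                   (successors-redirect C≗ C₂≡C₃ R x))
  , count⇒any (successors sharedTarget R 2 _) (successors sharedTarget R 3 _) fourNodes
              (successors-twins (⟦ C ⟧ sharedTarget) R)
redirect-invisible (¬' C) with redirect-invisible C
... | C≗ , C₂≡C₃ = (λ x → cong not (C≗ x)) , cong not C₂≡C₃
redirect-invisible (C ∨' D) with redirect-invisible C | redirect-invisible D
... | C≗ , C₂≡C₃ | D≗ , D₂≡D₃ = (λ x → cong₂ _∨_ (C≗ x) (D≗ x)) , cong₂ _∨_ C₂≡C₃ D₂≡D₃
redirect-invisible (lt n R C) with redirect-invisible C
... | C≗ , C₂≡C₃ = (λ x → cong (_<ᵇ n) (successors-redirect C≗ C₂≡C₃ R x))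
                 , cong (_<ᵇ n) (successors-twins (⟦ C ⟧ sharedTarget) R)
redirect-invisible (self r) = self≗ , refl
  where
    self≗ : ⟦ self r ⟧ sharedTarget ≗ ⟦ self r ⟧ distinctTargets
    self≗ 0             = refl
    self≗ 1             = refl
    self≗ (suc (suc x)) = refl

mainTheorem7 : (L : Logic) →
    Σ (Concept L) λ C → Σ Nominal λ i → Σ Nominal λ j →
      ¬ (Σ (Concept L) λ D →
           ∀ (G : Graph) → WellFormed G → SameExt G D (mrg i j G) C)
mainTheorem7 L = lt 2 (atom 0) ⊤' , 0 , 1 , λ (D , D-expresses) →
  true≢false (trans (sym (D-expresses sharedTarget wf-sharedTarget 0))
             (trans (proj₁ (redirect-invisible D) 0)
                    (D-expresses distinctTargets wf-distinctTargets 0)))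
  where
    true≢false : true ≡ false → ⊥
    true≢false ()
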